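{- Let $D$ be a digraph of maximum total degree $\Delta$. Then there exists a total order $\prec$ on $V(D)$ such that $\deg_{D[\prec]}(v) \le \lfloor \deg_D(v)/2 \rfloor$ for every vertex $v\in V(D)$.
   Context: For a digraph $D$ and a total order $\prec$ on $V(D)$, $D[\prec]$ denotes the subdigraph of $D$ on $V(D)$ consisting of the arcs $(v,u)\in A(D)$ with $u\prec v$ (orientations may be ignored). $\deg_D(v)$ is the total degree of $v$ in $D$ (number of incident arcs, in- plus out-). -}

module Defs where

open import Data.Nat using (ℕ; _+_)
open import Data.Bool using (Bool; true; false; if_then_else_; _∧_)
open import Data.Fin using (Fin)
open import Data.List using (List; allFin; map)
open import Data.Nat.ListAction using (sum)
open import Relation.Binary.PropositionalEquality using (_≡_)
open import Relation.Binary.Structures using (IsStrictTotalOrder)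
open import Relation.Nullary.Decidable using (⌊_⌋)

-- A finite (simple, loopless) digraph on vertex set Fin n:
-- arc u v = true  iff  (u , v) ∈ A(D), i.e. an arc from u to v.
-- Opposite arcs (u,v) and (v,u) may both be present.
record Digraph (n : ℕ) : Set where
  field
    arc      : Fin n → Fin n → Bool
    loopless : ∀ v → arc v v ≡ false
open Digraph public

count : ∀ {n} → (Fin n → Bool) → ℕ
count {n} f = sum (map (λ i → if f i then 1 else 0) (allFin n))

deg : ∀ {n} → Digraph n → Fin n → ℕ
deg D v = count (λ u → arc D v u) + count (λ u → arc D u v)

-- degree of v in D[≺]: D[≺] keeps the arcs (x , y) of D with y ≺ x.
degOrd : ∀ {n} (D : Digraph n) {_≺_ : Fin n → Fin n → Set} →
         IsStrictTotalOrder _≡_ _≺_ → Fin n → ℕ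
degOrd D {_≺_} sto v =
    count (λ u → arc D v u ∧ ⌊ u <? v ⌋)
  + count (λ u → arc D u v ∧ ⌊ v <? u ⌋)
  where open IsStrictTotalOrder sto using (_<?_)

-- Among the orders given by natural-number keys (ties broken by the vertex index), take one
-- minimising the total number of arcs of D[≺], counted at both ends. If some vertex v had
-- more than ⌊deg v / 2⌋ such arcs, moving v to the front of the order (which turns exactly
-- the arcs into v into arcs of D[≺]) or to its back (the arcs out of v) would leave every
-- other pair in place and strictly decrease that number, since min(indeg v, outdeg v) ≤
-- ⌊deg v / 2⌋.
module Submission where

open import Defs
open import Data.Nat using (ℕ; _≤_; ⌊_/2⌋)
open import Data.Fin using (Fin)
open import Data.Product using (Σ; _×_)
open import Relation.Binary.PropositionalEquality using (_≡_)
open import Relation.Binary.Structures using (IsStrictTotalOrder)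

open import Level using (0ℓ)
open import Data.Nat using (zero; suc; _+_; _<_; _≤?_; z<s; s≤s)
open import Data.Nat.Properties
  using ( +-0-commutativeMonoid; <-isStrictTotalOrder; +-comm; +-identityʳ
        ; m≤m+n; ≤-trans; ≤-reflexive; +-monoʳ-<; +-cancelˡ-<; +-cancelˡ-≡; +-mono-<; +-monoˡ-<
        ; +-monoʳ-≤; <⇒≤; ≰⇒>; n≡⌊n+n/2⌋; ⌊n/2⌋-mono; module ≤-Reasoning )
open import Data.Nat.Induction using (<-wellFounded)
open import Data.Fin as Fin using (zero; suc; punchIn; _≟_)
open import Data.Fin.Properties using (all?; ¬∀⟶∃¬; punchInᵢ≢i)
import Data.Fin.Properties as Finₚ
open import Data.Bool using (Bool; true; false; if_then_else_; _∧_)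
open import Data.Bool.Properties using (∧-zeroʳ; ∧-identityʳ)
open import Data.List using (tabulate)
open import Data.List.Properties using (map-tabulate)
import Data.Nat.ListAction as List
open import Data.Vec.Functional using (Vector; updateAt)
open import Data.Vec.Functional.Properties using (updateAt-updates; updateAt-minimal)
open import Algebra.Properties.CommutativeMonoid.Sum +-0-commutativeMonoid
  using (sum; sum-cong-≗; sum-remove; ∑-distrib-+)
open import Data.Product using (_,_; proj₂)
open import Data.Product.Relation.Binary.Lex.Strict using (×-Lex; ×-isStrictTotalOrder)
open import Data.Sum using (inj₁; inj₂)
open import Function using (_∘_; id; _⇔_; mk⇔)
open import Induction.WellFounded using (module All)
open import Relation.Binary.Core using (Rel)
open import Relation.Binary.Definitions using (Trichotomous; tri<; tri≈; tri>)
open import Relation.Binary.Structures.Biased using (isStrictTotalOrderᶜ)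
import Relation.Binary.Construct.On as On
open import Relation.Binary.PropositionalEquality
  using (refl; sym; trans; cong; cong₂; subst₂; isEquivalence; _≢_; module ≡-Reasoning)
open import Relation.Nullary using (¬_; yes; no)
open import Relation.Nullary.Decidable using (Dec; ⌊_⌋; isYes≗does; dec-true; dec-false; does-⇔)

-- degOrd is phrased with ⌊_⌋ = isYes, which agrees with does only propositionally.
⌊⌋-true : ∀ {a} {A : Set a} (a? : Dec A) → A → ⌊ a? ⌋ ≡ true
⌊⌋-true a? a = trans (isYes≗does a?) (dec-true a? a)

⌊⌋-false : ∀ {a} {A : Set a} (a? : Dec A) → ¬ A → ⌊ a? ⌋ ≡ false
⌊⌋-false a? ¬a = trans (isYes≗does a?) (dec-false a? ¬a)

⌊⌋-⇔ : ∀ {a b} {A : Set a} {B : Set b} → A ⇔ B →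
       (a? : Dec A) (b? : Dec B) → ⌊ a? ⌋ ≡ ⌊ b? ⌋
⌊⌋-⇔ A⇔B a? b? = trans (isYes≗does a?) (trans (does-⇔ A⇔B a? b?) (sym (isYes≗does b?)))

indicator : Bool → ℕ
indicator b = if b then 1 else 0

sum-tabulate : ∀ {n} (f : Vector ℕ n) → List.sum (tabulate f) ≡ sum f
sum-tabulate {zero}  f = refl
sum-tabulate {suc n} f = cong (f zero +_) (sum-tabulate (f ∘ suc))

count≡sum : ∀ {n} (p : Fin n → Bool) → count p ≡ sum (indicator ∘ p)
count≡sum p = trans (cong List.sum (map-tabulate id (indicator ∘ p))) (sum-tabulate (indicator ∘ p))

≤-sum : ∀ {n} (f : Vector ℕ n) (i : Fin n) → f i ≤ sum f
≤-sum {suc n} f i = ≤-trans (m≤m+n (f i) _) (≤-reflexive (sym (sum-remove {i = i} f)))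

sum²-pivot : ∀ {n} (h : Fin (suc n) → Fin (suc n) → ℕ) (v : Fin (suc n)) →
  h v v ≡ 0 → (∀ x → h x v ≡ h v x) →
  sum (λ x → sum (h x))
    ≡ sum (h v) + (sum (h v) + sum (λ x → sum (λ y → h (punchIn v x) (punchIn v y))))
sum²-pivot h v hvv≡0 h-sym = begin
  sum (λ x → sum (h x))
    ≡⟨ sum-remove {i = v} (λ x → sum (h x)) ⟩
  sum (h v) + sum (λ x → sum (h (punchIn v x)))
    ≡⟨ cong (sum (h v) +_) (sum-cong-≗ (λ x → sum-remove {i = v} (h (punchIn v x)))) ⟩
  sum (h v) + sum (λ x → h (punchIn v x) v + rest x)
    ≡⟨ cong (sum (h v) +_) (∑-distrib-+ (λ x → h (punchIn v x) v) rest) ⟩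
  sum (h v) + (sum (λ x → h (punchIn v x) v) + sum rest)
    ≡⟨ cong (λ c → sum (h v) + (c + sum rest)) column ⟩
  sum (h v) + (sum (h v) + sum rest) ∎
  where
  open ≡-Reasoning
  rest : Fin _ → ℕ
  rest x = sum (λ y → h (punchIn v x) (punchIn v y))
  column : sum (λ x → h (punchIn v x) v) ≡ sum (h v)
  column = begin
    sum (λ x → h (punchIn v x) v)   ≡⟨ sum-cong-≗ (h-sym ∘ punchIn v) ⟩
    sum (h v ∘ punchIn v)           ≡⟨ cong (_+ sum (h v ∘ punchIn v)) (sym hvv≡0) ⟩
    h v v + sum (h v ∘ punchIn v)   ≡⟨ sym (sum-remove {i = v} (h v)) ⟩
    sum (h v)                       ∎

KeyOrder : ∀ {n} → Vector ℕ n → Rel (Fin n) 0ℓ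
KeyOrder k x y = ×-Lex _≡_ _<_ Fin._<_ (k x , x) (k y , y)

keyOrder-isStrictTotalOrder : ∀ {n} (k : Vector ℕ n) → IsStrictTotalOrder _≡_ (KeyOrder k)
keyOrder-isStrictTotalOrder k = isStrictTotalOrderᶜ record
  { isEquivalence = isEquivalence
  ; trans         = Lex.trans
  ; compare       = compare
  }
  where
  module Lex = IsStrictTotalOrder
    (On.isStrictTotalOrder (λ x → k x , x)
      (×-isStrictTotalOrder <-isStrictTotalOrder Finₚ.<-isStrictTotalOrder))
  compare : Trichotomous _≡_ (KeyOrder k)
  compare x y with Lex.compare x y
  ... | tri< x≺y x≉y y⊀x = tri< x≺y (λ { refl → x≉y (refl , refl) }) y⊀x
  ... | tri≈ x⊀y x≈y y⊀x = tri≈ x⊀y (proj₂ x≈y) y⊀x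
  ... | tri> x⊀y x≉y y≺x = tri> x⊀y (λ { refl → x≉y (refl , refl) }) y≺x

keyOrder-shift : ∀ {n} (k k′ : Vector ℕ n) (c : ℕ) {x y : Fin n} →
  k′ x ≡ c + k x → k′ y ≡ c + k y → KeyOrder k x y ⇔ KeyOrder k′ x y
keyOrder-shift k k′ c {x} {y} eqx eqy = mk⇔ to from
  where
  to : KeyOrder k x y → KeyOrder k′ x y
  to (inj₁ kx<ky)         = inj₁ (subst₂ _<_ (sym eqx) (sym eqy) (+-monoʳ-< c kx<ky))
  to (inj₂ (kx≡ky , x<y)) = inj₂ (trans eqx (trans (cong (c +_) kx≡ky) (sym eqy)) , x<y)
  from : KeyOrder k′ x y → KeyOrder k x y
  from (inj₁ k′x<k′y)          = inj₁ (+-cancelˡ-< c _ _ (subst₂ _<_ eqx eqy k′x<k′y))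
  from (inj₂ (k′x≡k′y , x<y)) = inj₂ (+-cancelˡ-≡ c _ _ (trans (sym eqx) (trans k′x≡k′y eqy)) , x<y)

moveToFront moveToBack : ∀ {n} → Vector ℕ n → Fin n → Vector ℕ n
moveToFront k v = updateAt (suc ∘ k) v (λ _ → 0)
moveToBack  k v = updateAt k v (λ _ → suc (sum k))

moveToFront-least : ∀ {n} (k : Vector ℕ n) v {u} → u ≢ v → KeyOrder (moveToFront k v) v u
moveToFront-least k v {u} u≢v = inj₁ (subst₂ _<_ (sym (updateAt-updates v (suc ∘ k)))
  (sym (updateAt-minimal u v (suc ∘ k) u≢v)) z<s)

moveToBack-greatest : ∀ {n} (k : Vector ℕ n) v {u} → u ≢ v → KeyOrder (moveToBack k v) u v
moveToBack-greatest k v {u} u≢v = inj₁ (subst₂ _<_ (sym (updateAt-minimal u v k u≢v))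
  (sym (updateAt-updates v k)) (s≤s (≤-sum k u)))

moveToFront-shift : ∀ {n} (k : Vector ℕ n) v {x y} → x ≢ v → y ≢ v →
  KeyOrder k x y ⇔ KeyOrder (moveToFront k v) x y
moveToFront-shift k v {x} {y} x≢v y≢v = keyOrder-shift k (moveToFront k v) 1
  (updateAt-minimal x v (suc ∘ k) x≢v) (updateAt-minimal y v (suc ∘ k) y≢v)

moveToBack-shift : ∀ {n} (k : Vector ℕ n) v {x y} → x ≢ v → y ≢ v →
  KeyOrder k x y ⇔ KeyOrder (moveToBack k v) x y
moveToBack-shift k v {x} {y} x≢v y≢v = keyOrder-shift k (moveToBack k v) 0
  (updateAt-minimal x v k x≢v) (updateAt-minimal y v k y≢v)

module _ {n : ℕ} (D : Digraph n) where

  outdeg indeg : Fin n → ℕ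
  outdeg v = count (λ u → arc D v u)
  indeg  v = count (λ u → arc D u v)

  module _ {_≺_ : Rel (Fin n) 0ℓ} (sto : IsStrictTotalOrder _≡_ _≺_) where
    open IsStrictTotalOrder sto using (asym) renaming (_<?_ to _≺?_)

    backward : Fin n → Fin n → ℕ
    backward v u = indicator (arc D v u ∧ ⌊ u ≺? v ⌋) + indicator (arc D u v ∧ ⌊ v ≺? u ⌋)

    degOrd≡sum-backward : ∀ v → degOrd D sto v ≡ sum (backward v)
    degOrd≡sum-backward v = trans (cong₂ _+_ (count≡sum out) (count≡sum into))
                                  (sym (∑-distrib-+ (indicator ∘ out) (indicator ∘ into)))
      where
      out into : Fin n → Bool
      out  u = arc D v u ∧ ⌊ u ≺? v ⌋
      into u = arc D u v ∧ ⌊ v ≺? u ⌋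

    backward-comm : ∀ u v → backward u v ≡ backward v u
    backward-comm u v = +-comm (indicator (arc D u v ∧ ⌊ v ≺? u ⌋)) _

    backward-self : ∀ v → backward v v ≡ 0
    backward-self v rewrite loopless D v = refl

    degOrd-least : ∀ v → (∀ {u} → u ≢ v → v ≺ u) → degOrd D sto v ≡ indeg v
    degOrd-least v least = begin
      degOrd D sto v                  ≡⟨ degOrd≡sum-backward v ⟩
      sum (backward v)                ≡⟨ sum-cong-≗ backward-into ⟩
      sum (indicator ∘ λ u → arc D u v) ≡⟨ count≡sum (λ u → arc D u v) ⟨
      indeg v                         ∎
      where
      open ≡-Reasoning
      backward-into : ∀ u → backward v u ≡ indicator (arc D u v)
      backward-into u with u ≟ v
      ... | yes refl rewrite loopless D v = refl
      ... | no u≢v rewrite ⌊⌋-false (u ≺? v) (asym (least u≢v))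
                         | ⌊⌋-true (v ≺? u) (least u≢v)
                         | ∧-zeroʳ (arc D v u) | ∧-identityʳ (arc D u v) = refl

    degOrd-greatest : ∀ v → (∀ {u} → u ≢ v → u ≺ v) → degOrd D sto v ≡ outdeg v
    degOrd-greatest v greatest = begin
      degOrd D sto v                  ≡⟨ degOrd≡sum-backward v ⟩
      sum (backward v)                ≡⟨ sum-cong-≗ backward-out ⟩
      sum (indicator ∘ λ u → arc D v u) ≡⟨ count≡sum (λ u → arc D v u) ⟨
      outdeg v                        ∎
      where
      open ≡-Reasoning
      backward-out : ∀ u → backward v u ≡ indicator (arc D v u)
      backward-out u with u ≟ v
      ... | yes refl rewrite loopless D v = refl
      ... | no u≢v rewrite ⌊⌋-true (u ≺? v) (greatest u≢v)
                         | ⌊⌋-false (v ≺? u) (asym (greatest u≢v))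
                         | ∧-identityʳ (arc D v u) | ∧-zeroʳ (arc D u v) = +-identityʳ _

  degOrdSum : {_≺_ : Rel (Fin n) 0ℓ} → IsStrictTotalOrder _≡_ _≺_ → ℕ
  degOrdSum sto = sum (degOrd D sto)

-- Twice the number of arcs of D[≺] not incident to v.
degOrdSumAvoiding : ∀ {n} (D : Digraph (suc n)) {_≺_ : Rel (Fin (suc n)) 0ℓ} →
  IsStrictTotalOrder _≡_ _≺_ → Fin (suc n) → ℕ
degOrdSumAvoiding D sto v = sum (λ x → sum (λ y → backward D sto (punchIn v x) (punchIn v y)))

degOrdSum-pivot : ∀ {n} (D : Digraph (suc n)) {_≺_ : Rel (Fin (suc n)) 0ℓ}
  (sto : IsStrictTotalOrder _≡_ _≺_) (v : Fin (suc n)) →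
  degOrdSum D sto ≡ degOrd D sto v + (degOrd D sto v + degOrdSumAvoiding D sto v)
degOrdSum-pivot D sto v = begin
  degOrdSum D sto
    ≡⟨ sum-cong-≗ (degOrd≡sum-backward D sto) ⟩
  sum (λ x → sum (backward D sto x))
    ≡⟨ sum²-pivot (backward D sto) v (backward-self D sto v) (λ x → backward-comm D sto x v) ⟩
  sum (backward D sto v) + (sum (backward D sto v) + degOrdSumAvoiding D sto v)
    ≡⟨ cong (λ d → d + (d + degOrdSumAvoiding D sto v)) (degOrd≡sum-backward D sto v) ⟨
  degOrd D sto v + (degOrd D sto v + degOrdSumAvoiding D sto v) ∎
  where open ≡-Reasoning

degOrdSumAvoiding-cong : ∀ {n} (D : Digraph (suc n)) {_≺₁_ _≺₂_ : Rel (Fin (suc n)) 0ℓ}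
  (s₁ : IsStrictTotalOrder _≡_ _≺₁_) (s₂ : IsStrictTotalOrder _≡_ _≺₂_) (v : Fin (suc n)) →
  (∀ {x y} → x ≢ v → y ≢ v → x ≺₁ y ⇔ x ≺₂ y) →
  degOrdSumAvoiding D s₁ v ≡ degOrdSumAvoiding D s₂ v
degOrdSumAvoiding-cong D s₁ s₂ v agree = sum-cong-≗ λ x → sum-cong-≗ λ y →
  cong₂ (λ b c → indicator (arc D (punchIn v x) (punchIn v y) ∧ b)
               + indicator (arc D (punchIn v y) (punchIn v x) ∧ c))
        (same-order y x) (same-order x y)
  where
  same-order : ∀ x y → ⌊ IsStrictTotalOrder._<?_ s₁ (punchIn v x) (punchIn v y) ⌋
                     ≡ ⌊ IsStrictTotalOrder._<?_ s₂ (punchIn v x) (punchIn v y) ⌋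
  same-order x y = ⌊⌋-⇔ (agree (punchInᵢ≢i v x) (punchInᵢ≢i v y)) _ _

degOrdSum-< : ∀ {n} (D : Digraph n) {_≺₁_ _≺₂_ : Rel (Fin n) 0ℓ}
  (s₁ : IsStrictTotalOrder _≡_ _≺₁_) (s₂ : IsStrictTotalOrder _≡_ _≺₂_) (v : Fin n) →
  (∀ {x y} → x ≢ v → y ≢ v → x ≺₁ y ⇔ x ≺₂ y) →
  degOrd D s₂ v < degOrd D s₁ v → degOrdSum D s₂ < degOrdSum D s₁
degOrdSum-< {suc n} D s₁ s₂ v agree smaller = begin-strict
  degOrdSum D s₂         ≡⟨ degOrdSum-pivot D s₂ v ⟩
  d₂ + (d₂ + avoiding₂)  ≡⟨ cong (λ a → d₂ + (d₂ + a)) (degOrdSumAvoiding-cong D s₁ s₂ v agree) ⟨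
  d₂ + (d₂ + avoiding₁)  <⟨ +-mono-< smaller (+-monoˡ-< avoiding₁ smaller) ⟩
  d₁ + (d₁ + avoiding₁)  ≡⟨ degOrdSum-pivot D s₁ v ⟨
  degOrdSum D s₁         ∎
  where
  open ≤-Reasoning
  d₁ = degOrd D s₁ v
  d₂ = degOrd D s₂ v
  avoiding₁ = degOrdSumAvoiding D s₁ v
  avoiding₂ = degOrdSumAvoiding D s₂ v

m≤n⇒m≤⌊m+n/2⌋ : ∀ {m n} → m ≤ n → m ≤ ⌊ m + n /2⌋
m≤n⇒m≤⌊m+n/2⌋ {m} m≤n = ≤-trans (≤-reflexive (n≡⌊n+n/2⌋ m)) (⌊n/2⌋-mono (+-monoʳ-≤ m m≤n))

Balanced : ∀ {n} (D : Digraph n) {_≺_ : Rel (Fin n) 0ℓ} → IsStrictTotalOrder _≡_ _≺_ → Set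
Balanced D sto = ∀ v → degOrd D sto v ≤ ⌊ deg D v /2⌋

module _ {n : ℕ} (D : Digraph n) where
  private
    keyDegOrd : Vector ℕ n → Fin n → ℕ
    keyDegOrd k = degOrd D (keyOrder-isStrictTotalOrder k)

    keyDegOrdSum : Vector ℕ n → ℕ
    keyDegOrdSum k = degOrdSum D (keyOrder-isStrictTotalOrder k)

    keyDegOrd-moveToFront : ∀ k v → keyDegOrd (moveToFront k v) v ≡ indeg D v
    keyDegOrd-moveToFront k v =
      degOrd-least D (keyOrder-isStrictTotalOrder (moveToFront k v)) v (moveToFront-least k v)

    keyDegOrd-moveToBack : ∀ k v → keyDegOrd (moveToBack k v) v ≡ outdeg D v
    keyDegOrd-moveToBack k v =
      degOrd-greatest D (keyOrder-isStrictTotalOrder (moveToBack k v)) v (moveToBack-greatest k v)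

    keyDegOrdSum-< : ∀ {k k′ v} → (∀ {x y} → x ≢ v → y ≢ v → KeyOrder k x y ⇔ KeyOrder k′ x y) →
      keyDegOrd k′ v < keyDegOrd k v → keyDegOrdSum k′ < keyDegOrdSum k
    keyDegOrdSum-< {k} {k′} {v} =
      degOrdSum-< D (keyOrder-isStrictTotalOrder k) (keyOrder-isStrictTotalOrder k′) v

  improvingMove : ∀ k v → ⌊ deg D v /2⌋ < keyDegOrd k v →
    Σ (Vector ℕ n) λ k′ → keyDegOrdSum k′ < keyDegOrdSum k
  improvingMove k v unbalanced with outdeg D v ≤? indeg D v
  ... | yes out≤in = moveToBack k v , keyDegOrdSum-< (moveToBack-shift k v) (begin-strict
    keyDegOrd (moveToBack k v) v  ≡⟨ keyDegOrd-moveToBack k v ⟩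
    outdeg D v                    ≤⟨ m≤n⇒m≤⌊m+n/2⌋ out≤in ⟩
    ⌊ deg D v /2⌋                 <⟨ unbalanced ⟩
    keyDegOrd k v                 ∎)
    where open ≤-Reasoning
  ... | no out≰in = moveToFront k v , keyDegOrdSum-< (moveToFront-shift k v) (begin-strict
    keyDegOrd (moveToFront k v) v  ≡⟨ keyDegOrd-moveToFront k v ⟩
    indeg D v                      ≤⟨ m≤n⇒m≤⌊m+n/2⌋ (<⇒≤ (≰⇒> out≰in)) ⟩
    ⌊ indeg D v + outdeg D v /2⌋   ≡⟨ cong ⌊_/2⌋ (+-comm (indeg D v) (outdeg D v)) ⟩
    ⌊ deg D v /2⌋                  <⟨ unbalanced ⟩
    keyDegOrd k v                  ∎)
    where open ≤-Reasoning

  BalancedKey : Set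
  BalancedKey = Σ (Vector ℕ n) λ k → Balanced D (keyOrder-isStrictTotalOrder k)

  balancedKey : Vector ℕ n → BalancedKey
  balancedKey = All.wfRec (On.wellFounded keyDegOrdSum <-wellFounded) 0ℓ _ descend
    where
    descend : ∀ k → (∀ {k′} → keyDegOrdSum k′ < keyDegOrdSum k → BalancedKey) → BalancedKey
    descend k recurse with all? (λ v → keyDegOrd k v ≤? ⌊ deg D v /2⌋)
    ... | yes balanced = k , balanced
    ... | no unbalanced with ¬∀⟶∃¬ n _ (λ v → keyDegOrd k v ≤? ⌊ deg D v /2⌋) unbalanced
    ...   | v , v-unbalanced = recurse (proj₂ (improvingMove k v (≰⇒> v-unbalanced)))

mainTheorem6 : (n : ℕ) (D : Digraph n) →
    Σ (Fin n → Fin n → Set) λ _≺_ →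
      Σ (IsStrictTotalOrder _≡_ _≺_) λ sto →
        (v : Fin n) → degOrd D sto v ≤ ⌊ deg D v /2⌋
mainTheorem6 n D with balancedKey D (λ _ → 0)
... | k , balanced = KeyOrder k , keyOrder-isStrictTotalOrder k , balanced
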